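{- Let $G$ be a connected graph of order $n\ge 2$ and let $H$ be a non-trivial graph (i.e. of order at least $2$). Then $$\operatorname{dim}(G\odot H)=n\cdot \operatorname{dim}_A(H).$$
   Context: All graphs are finite, simple, undirected and loop-free. For a connected graph $G$, $d_G(x,y)$ is the length of a shortest $x$–$y$ path. A vertex $s$ distinguishes $x,y$ if $d_G(s,x)\neq d_G(s,y)$. A set $S\subseteq V(G)$ is a metric generator if every pair of distinct vertices of $G$ is distinguished by some element of $S$; $\operatorname{dim}(G)$ (metric dimension) is the minimum cardinality of a metric generator. A set $S\subseteq V(H)$ is an adjacency generator for a graph $H$ if for every two distinct vertices $x,y\in V(H)\setminus S$ there exists $s\in S$ with $|N_H(s)\cap\{x,y\}|=1$, where $N_H(s)$ is the open neighbourhood; $\operatorname{dim}_A(H)$ (adjacency dimension) is the minimum cardinality of an adjacency generator. The corona product $G\odot H$, for $G$ of order $n$ with vertices $v_1,\dots,v_n$, is obtained from one copy of $G$ and $n$ disjoint copies $H_1,\dots,H_n$ of $H$ by joining $v_i$ by an edge to every vertex of $H_i$, for each $i$. -}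

module Defs where

open import Data.Nat using (ℕ; zero; suc; _+_; _*_; _≤_)
open import Data.Fin using (Fin; splitAt; quotRem)
open import Data.Fin.Subset using (Subset; _∈_; _∉_; ∣_∣)
open import Data.Bool using (Bool; true; false; _∧_)
open import Data.Sum using (_⊎_; inj₁; inj₂)
open import Data.Product using (Σ; ∃; _×_; _,_)
open import Relation.Binary.PropositionalEquality using (_≡_; _≢_)
open import Relation.Nullary using (¬_; does)
import Data.Fin as F

record Graph (n : ℕ) : Set where
  field
    adj    : Fin n → Fin n → Bool
    sym    : ∀ x y → adj x y ≡ adj y x
    irrefl : ∀ x → adj x x ≡ false
open Graph public

_∼⟨_⟩_ : ∀ {n} → Fin n → Graph n → Fin n → Set
x ∼⟨ G ⟩ y = adj G x y ≡ true

data Walk {n} (G : Graph n) : Fin n → Fin n → ℕ → Set where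
  here : ∀ {x} → Walk G x x zero
  step : ∀ {x y z k} → x ∼⟨ G ⟩ y → Walk G y z k → Walk G x z (suc k)

Connected : ∀ {n} → Graph n → Set
Connected G = ∀ x y → ∃ λ k → Walk G x y k

Dist : ∀ {n} → Graph n → Fin n → Fin n → ℕ → Set
Dist G x y k = Walk G x y k × (∀ j → Walk G x y j → k ≤ j)

Distinguishes : ∀ {n} → Graph n → Fin n → Fin n → Fin n → Set
Distinguishes G s x y =
  Σ ℕ λ a → Σ ℕ λ b → Dist G s x a × Dist G s y b × a ≢ b

IsMetricGenerator : ∀ {n} → Graph n → Subset n → Set
IsMetricGenerator G S =
  ∀ x y → x ≢ y → Σ _ λ s → s ∈ S × Distinguishes G s x y

IsMetricDimension : ∀ {n} → Graph n → ℕ → Set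
IsMetricDimension G d =
  (Σ _ λ S → IsMetricGenerator G S × ∣ S ∣ ≡ d)
  × (∀ S → IsMetricGenerator G S → d ≤ ∣ S ∣)

IsAdjacencyGenerator : ∀ {n} → Graph n → Subset n → Set
IsAdjacencyGenerator H S =
  ∀ x y → x ≢ y → x ∉ S → y ∉ S →
    Σ _ λ s → s ∈ S × ¬ (adj H s x ≡ adj H s y)

IsAdjacencyDimension : ∀ {n} → Graph n → ℕ → Set
IsAdjacencyDimension H d =
  (Σ _ λ S → IsAdjacencyGenerator H S × ∣ S ∣ ≡ d)
  × (∀ S → IsAdjacencyGenerator H S → d ≤ ∣ S ∣)

-- Vertices of G ⊙ H (G of order n, H of order m): Fin (n + n * m),
-- decoded as either a vertex v_i of G (inj₁ i) or vertex h of copy H_i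
-- (inj₂ (i , h)).
coronaVertex : ∀ n m → Fin (n + n * m) → Fin n ⊎ (Fin n × Fin m)
coronaVertex n m v with splitAt n v
... | inj₁ i = inj₁ i
... | inj₂ w with quotRem {n} m w
...   | (h , i) = inj₂ (i , h)

coronaAdj′ : ∀ {n m} → Graph n → Graph m →
  Fin n ⊎ (Fin n × Fin m) → Fin n ⊎ (Fin n × Fin m) → Bool
coronaAdj′ G H (inj₁ i) (inj₁ j) = adj G i j
coronaAdj′ G H (inj₁ i) (inj₂ (j , h)) = does (i F.≟ j)
coronaAdj′ G H (inj₂ (i , h)) (inj₁ j) = does (j F.≟ i)
coronaAdj′ G H (inj₂ (i , h)) (inj₂ (j , h′)) = does (i F.≟ j) ∧ adj H h h′

coronaAdj′-sym : ∀ {n m} (G : Graph n) (H : Graph m) x y →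
  coronaAdj′ G H x y ≡ coronaAdj′ G H y x
coronaAdj′-sym G H (inj₁ i) (inj₁ j) = sym G i j
coronaAdj′-sym G H (inj₁ i) (inj₂ (j , h)) = Relation.Binary.PropositionalEquality.refl
coronaAdj′-sym G H (inj₂ (i , h)) (inj₁ j) = Relation.Binary.PropositionalEquality.refl
coronaAdj′-sym G H (inj₂ (i , h)) (inj₂ (j , h′)) with i F.≟ j | j F.≟ i
... | Relation.Nullary.yes _ | Relation.Nullary.yes _ = sym H h h′
... | Relation.Nullary.no _ | Relation.Nullary.no _ = Relation.Binary.PropositionalEquality.refl
... | Relation.Nullary.yes p | Relation.Nullary.no q = Data.Empty.⊥-elim (q (Relation.Binary.PropositionalEquality.sym p))
  where import Data.Empty
... | Relation.Nullary.no q | Relation.Nullary.yes p = Data.Empty.⊥-elim (q (Relation.Binary.PropositionalEquality.sym p))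
  where import Data.Empty

coronaAdj′-irrefl : ∀ {n m} (G : Graph n) (H : Graph m) x →
  coronaAdj′ G H x x ≡ false
coronaAdj′-irrefl G H (inj₁ i) = irrefl G i
coronaAdj′-irrefl G H (inj₂ (i , h)) with i F.≟ i
... | Relation.Nullary.yes _ = irrefl H h
... | Relation.Nullary.no _ = Relation.Binary.PropositionalEquality.refl

corona : ∀ {n m} → Graph n → Graph m → Graph (n + n * m)
corona {n} {m} G H = record
  { adj    = λ x y → coronaAdj′ G H (coronaVertex n m x) (coronaVertex n m y)
  ; sym    = λ x y → coronaAdj′-sym G H (coronaVertex n m x) (coronaVertex n m y)
  ; irrefl = λ x → coronaAdj′-irrefl G H (coronaVertex n m x)
  }

-- A vertex outside the copy H_i reaches H_i only through its hub v_i, so it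
-- sees all of H_i at the same distance; inside H_i, two distinct vertices are
-- at distance 1 or 2 according as they are adjacent in H or not. Hence every
-- metric generator of G ⊙ H restricts on each copy to an adjacency generator
-- of H, which gives dim(G ⊙ H) ≥ n · dim_A(H). Conversely, placing a copy of
-- an adjacency basis A of H in every H_i resolves G ⊙ H: pairs inside one copy
-- are separated by the adjacency property, and every other pair by a vertex
-- of A in a suitable copy, because distinct copies lie at distance ≥ 3 and,
-- as n ≥ 2, a copy other than H_i sees v_i strictly closer than all of H_i.
module Submission where

open import Defs
open import Data.Bool using (Bool; true; false)
import Data.Bool as Bool
open import Data.Bool.Properties using (∧-conicalˡ)
open import Data.Empty using (⊥-elim)
open import Data.Fin as Fin using (Fin; toℕ; fromℕ<; _↑ˡ_; _↑ʳ_; combine; splitAt; quotRem; join; punchIn)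
import Data.Fin.Properties as Finₚ
open import Data.Fin.Subset using (Subset; _∈_; ∣_∣; Nonempty; ⊥)
import Data.Fin.Subset.Properties as Subsetₚ
open import Data.Nat using (ℕ; zero; suc; _+_; _*_; _≤_; _<_; z≤n; s≤s)
open import Data.Nat.Properties
  using (≤-refl; ≤-trans; ≤-antisym; ≤-<-trans; <⇒≢; ≮⇒≥; n<1+n; m<n⇒m<1+n; +-mono-≤; m≤n+m; 1+n≢n)
open import Data.Product using (Σ; ∃; ∃₂; _×_; _,_; proj₁; proj₂; swap; uncurry)
open import Data.Sum using (_⊎_; inj₁; inj₂)
open import Data.Unit using (⊤; tt)
open import Data.Vec using (Vec; []; _∷_; _++_; concat; replicate; lookup; map; sum; group)
import Data.Vec as Vec
import Data.Vec.Properties as Vecₚ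
open import Function using (_∘_)
open import Relation.Binary.PropositionalEquality as ≡
  using (_≡_; _≢_; refl; cong; cong₂; subst; subst₂; trans)
open import Relation.Nullary using (¬_; Dec; yes; no; does)
open import Relation.Nullary.Decidable using (dec-true; _×-dec_)

dec-true⁻¹ : ∀ {a} {A : Set a} (a? : Dec A) → does a? ≡ true → A
dec-true⁻¹ (yes a) _ = a
dec-true⁻¹ (no _) ()

∣p++q∣≡∣p∣+∣q∣ : ∀ {m n} (p : Subset m) (q : Subset n) → ∣ p ++ q ∣ ≡ ∣ p ∣ + ∣ q ∣
∣p++q∣≡∣p∣+∣q∣ []          q = refl
∣p++q∣≡∣p∣+∣q∣ (true  ∷ p) q = cong suc (∣p++q∣≡∣p∣+∣q∣ p q)
∣p++q∣≡∣p∣+∣q∣ (false ∷ p) q = ∣p++q∣≡∣p∣+∣q∣ p q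

∣concat∣≡sum : ∀ {m n} (ps : Vec (Subset m) n) → ∣ concat ps ∣ ≡ sum (map ∣_∣ ps)
∣concat∣≡sum []       = refl
∣concat∣≡sum (p ∷ ps) = trans (∣p++q∣≡∣p∣+∣q∣ p (concat ps)) (cong (∣ p ∣ +_) (∣concat∣≡sum ps))

sum-replicate : ∀ n c → sum (replicate n c) ≡ n * c
sum-replicate zero    c = refl
sum-replicate (suc n) c = cong (c +_) (sum-replicate n c)

*≤sum : ∀ {n a} (xs : Vec ℕ n) → (∀ i → a ≤ lookup xs i) → n * a ≤ sum xs
*≤sum []       _  = z≤n
*≤sum (x ∷ xs) a≤ = +-mono-≤ (a≤ Fin.zero) (*≤sum xs (a≤ ∘ Fin.suc))

module _ {N} (K : Graph N) where

  walk-length-zero : ∀ {x y} → Walk K x y 0 → x ≡ y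
  walk-length-zero here = refl

  walk? : ∀ k x y → Dec (Walk K x y k)
  walk? zero x y with x Fin.≟ y
  ... | yes refl = yes here
  ... | no x≢y   = no (x≢y ∘ walk-length-zero)
  walk? (suc k) x y with Finₚ.any? (λ z → (adj K x z Bool.≟ true) ×-dec walk? k z y)
  ... | yes (_ , x∼z , w) = yes (step x∼z w)
  ... | no ∄z             = no λ { (step x∼z w) → ∄z (_ , x∼z , w) }

  dist-exists : ∀ {x y k} → Walk K x y k → ∃ (Dist K x y)
  dist-exists {k = k} = shortest k ≤-refl
    where
    -- Either a walk of length ≤ b exists, or the given one, of length ≤ 1 + b, is shortest.
    shortest : ∀ {x y} b {j} → j ≤ b → Walk K x y j → ∃ (Dist K x y)
    shortest zero z≤n w = 0 , w , λ _ _ → z≤n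
    shortest {x} {y} (suc b) {j} j≤1+b w with Finₚ.any? (λ (i : Fin (suc b)) → walk? (toℕ i) x y)
    ... | yes (i , wᵢ) = shortest b (Finₚ.toℕ≤pred[n] i) wᵢ
    ... | no none      = j , w , λ l wₗ → ≤-trans j≤1+b (≮⇒≥ λ l<1+b →
          none (fromℕ< l<1+b , subst (Walk K x y) (≡.sym (Finₚ.toℕ-fromℕ< l<1+b)) wₗ))

  Dist-unique : ∀ {x y a b} → Dist K x y a → Dist K x y b → a ≡ b
  Dist-unique (wa , a-min) (wb , b-min) = ≤-antisym (a-min _ wb) (b-min _ wa)

  distinguishes-sym : ∀ {s x y} → Distinguishes K s x y → Distinguishes K s y x
  distinguishes-sym (a , b , da , db , a≢b) = b , a , db , da , a≢b ∘ ≡.sym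

  distinguishes-by-walks : ∀ {s x y p q} → Walk K s x p → Walk K s y q →
    (∀ k → Walk K s y k → p < k) → Distinguishes K s x y
  distinguishes-by-walks wx wy longer with dist-exists wx | dist-exists wy
  ... | a , da | b , db = a , b , da , db , <⇒≢ (≤-<-trans (proj₂ da _ wx) (longer b (proj₁ db)))

another-vertex : ∀ {n} → 2 ≤ n → (i : Fin n) → ∃ λ k → k ≢ i
another-vertex (s≤s (s≤s _)) i = punchIn i Fin.zero , Finₚ.punchInᵢ≢i i Fin.zero

adjacency-generator-nonempty : ∀ {m} (H : Graph m) {A : Subset m} →
  2 ≤ m → IsAdjacencyGenerator H A → Nonempty A
adjacency-generator-nonempty H {A} (s≤s (s≤s _)) gen
  with Fin.zero Subsetₚ.∈? A | Fin.suc Fin.zero Subsetₚ.∈? A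
... | yes 0∈A | _       = _ , 0∈A
... | no _    | yes 1∈A = _ , 1∈A
... | no 0∉A  | no 1∉A  = let s , s∈A , _ = gen _ _ (λ ()) 0∉A 1∉A in s , s∈A

module Corona {n m} (G : Graph n) (H : Graph m) where

  Vertex : Set
  Vertex = Fin n ⊎ (Fin n × Fin m)

  pattern hub i    = inj₁ i
  pattern copy i h = inj₂ (i , h)

  C : Graph (n + n * m)
  C = corona G H

  dec : Fin (n + n * m) → Vertex
  dec = coronaVertex n m

  enc : Vertex → Fin (n + n * m)
  enc (hub i)    = i ↑ˡ (n * m)
  enc (copy i h) = n ↑ʳ combine i h

  dec-enc : ∀ v → dec (enc v) ≡ v
  dec-enc (hub i) rewrite Finₚ.splitAt-↑ˡ n i (n * m) = refl
  dec-enc (copy i h)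
    rewrite Finₚ.splitAt-↑ʳ n (n * m) (combine i h)
          | cong swap (Finₚ.remQuot-combine {k = m} i h) = refl

  enc-dec : ∀ x → enc (dec x) ≡ x
  enc-dec x with splitAt n x in split≡
  ... | inj₁ i = trans (cong (join n (n * m)) (≡.sym split≡)) (Finₚ.join-splitAt n (n * m) x)
  ... | inj₂ w with quotRem {n} m w in quotRem≡
  ...   | (h , i) = trans (cong (n ↑ʳ_) (trans (cong (uncurry combine ∘ swap) (≡.sym quotRem≡))
                                              (Finₚ.combine-remQuot {n} m w)))
                          (trans (cong (join n (n * m)) (≡.sym split≡)) (Finₚ.join-splitAt n (n * m) x))

  enc-injective : ∀ {u v} → enc u ≡ enc v → u ≡ v
  enc-injective {u} {v} e = trans (≡.sym (dec-enc u)) (trans (cong dec e) (dec-enc v))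

  dec-injective : ∀ {x y} → dec x ≡ dec y → x ≡ y
  dec-injective {x} {y} e = trans (≡.sym (enc-dec x)) (trans (cong enc e) (enc-dec y))

  hub-injective : ∀ {i j} → _≡_ {A = Vertex} (hub i) (hub j) → i ≡ j
  hub-injective refl = refl

  copy-injective : ∀ {i j h x} → _≡_ {A = Vertex} (copy i h) (copy j x) → h ≡ x
  copy-injective refl = refl

  _~_ : Vertex → Vertex → Set
  u ~ v = coronaAdj′ G H u v ≡ true

  ~-sym : ∀ {u v} → u ~ v → v ~ u
  ~-sym {u} {v} = trans (coronaAdj′-sym G H v u)

  hub~copy : ∀ i h → hub i ~ copy i h
  hub~copy i h = dec-true (i Fin.≟ i) refl

  copy~hub : ∀ i h → copy i h ~ hub i
  copy~hub i h = dec-true (i Fin.≟ i) refl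

  copy~hub⇒≡ : ∀ {i h j} → copy i h ~ hub j → j ≡ i
  copy~hub⇒≡ {i} {j = j} = dec-true⁻¹ (j Fin.≟ i)

  copy~copy⇒≡ : ∀ {i h j x} → copy i h ~ copy j x → i ≡ j
  copy~copy⇒≡ {i} {h} {j} {x} = dec-true⁻¹ (i Fin.≟ j) ∘ ∧-conicalˡ _ (adj H h x)

  adj-within-copy : ∀ i h x → coronaAdj′ G H (copy i h) (copy i x) ≡ adj H h x
  adj-within-copy i h x rewrite dec-true (i Fin.≟ i) refl = refl

  data Walk⊙ : Vertex → Vertex → ℕ → Set where
    here : ∀ {u} → Walk⊙ u u 0
    step : ∀ {u v w k} → u ~ v → Walk⊙ v w k → Walk⊙ u w (suc k)

  walk⊙-length-zero : ∀ {u v} → Walk⊙ u v 0 → u ≡ v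
  walk⊙-length-zero here = refl

  walk⊙-nonempty : ∀ {u v k} → u ≢ v → Walk⊙ u v k → 0 < k
  walk⊙-nonempty u≢v here       = ⊥-elim (u≢v refl)
  walk⊙-nonempty u≢v (step _ _) = s≤s z≤n

  snoc : ∀ {u v w k} → Walk⊙ u v k → v ~ w → Walk⊙ u w (suc k)
  snoc here       v~w = step v~w here
  snoc (step e p) v~w = step e (snoc p v~w)

  reverse : ∀ {u v k} → Walk⊙ u v k → Walk⊙ v u k
  reverse here       = here
  reverse (step {u} {v} e p) = snoc (reverse p) (~-sym {u} {v} e)

  lift : ∀ {i j k} → Walk G i j k → Walk⊙ (hub i) (hub j) k
  lift here       = here
  lift (step e p) = step e (lift p)

  connected⊙ : Connected G → ∀ u v → ∃ (Walk⊙ u v)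
  connected⊙ connected (hub i)    (hub j)    = _ , lift (proj₂ (connected i j))
  connected⊙ connected (hub i)    (copy j x) = _ , snoc (lift (proj₂ (connected i j))) (hub~copy j x)
  connected⊙ connected (copy i h) (hub j)    = _ , step (copy~hub i h) (lift (proj₂ (connected i j)))
  connected⊙ connected (copy i h) (copy j x) =
    _ , step (copy~hub i h) (snoc (lift (proj₂ (connected i j))) (hub~copy j x))

  toWalk⊙ : ∀ {x y k} → Walk C x y k → Walk⊙ (dec x) (dec y) k
  toWalk⊙ here       = here
  toWalk⊙ (step e p) = step e (toWalk⊙ p)

  toWalk⊙-enc : ∀ {u v k} → Walk C (enc u) (enc v) k → Walk⊙ u v k
  toWalk⊙-enc {u} {v} {k} = subst₂ (λ x y → Walk⊙ x y k) (dec-enc u) (dec-enc v) ∘ toWalk⊙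

  fromWalk⊙ : ∀ {u v k} → Walk⊙ u v k → Walk C (enc u) (enc v) k
  fromWalk⊙ here = here
  fromWalk⊙ (step {u} {v} e p) = step (subst₂ _~_ (≡.sym (dec-enc u)) (≡.sym (dec-enc v)) e) (fromWalk⊙ p)

  Dist⊙ : Vertex → Vertex → ℕ → Set
  Dist⊙ u v = Dist C (enc u) (enc v)

  dist⊙-walk : ∀ {u v a} → Dist⊙ u v a → Walk⊙ u v a
  dist⊙-walk = toWalk⊙-enc ∘ proj₁

  dist⊙-minimal : ∀ {u v a k} → Dist⊙ u v a → Walk⊙ u v k → a ≤ k
  dist⊙-minimal d p = proj₂ d _ (fromWalk⊙ p)

  dist⊙-intro : ∀ {u v a} → Walk⊙ u v a → (∀ k → Walk⊙ u v k → a ≤ k) → Dist⊙ u v a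
  dist⊙-intro p minimal = fromWalk⊙ p , λ k q → minimal k (toWalk⊙-enc q)

  dist⊙-exists : ∀ {u v k} → Walk⊙ u v k → ∃ (Dist⊙ u v)
  dist⊙-exists = dist-exists C ∘ fromWalk⊙

  distinguishes⊙-by-walks : ∀ {s u v p q} → Walk⊙ s u p → Walk⊙ s v q →
    (∀ k → Walk⊙ s v k → p < k) → Distinguishes C (enc s) (enc u) (enc v)
  distinguishes⊙-by-walks pu pv longer =
    distinguishes-by-walks C (fromWalk⊙ pu) (fromWalk⊙ pv) (λ k q → longer k (toWalk⊙-enc q))

  Outside : Fin n → Vertex → Set
  Outside i (hub _)    = ⊤
  Outside i (copy j _) = i ≢ j

  exit-copy : ∀ {i x t k} → Outside i t → Walk⊙ (copy i x) t k →
    ∃ λ k′ → Walk⊙ (hub i) t k′ × k′ < k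
  exit-copy out here = ⊥-elim (out refl)
  exit-copy {i} {x} out (step {v = hub j} e p) with copy~hub⇒≡ {i} {x} {j} e
  ... | refl = _ , p , n<1+n _
  exit-copy {i} {x} out (step {v = copy j h} e p) with copy~copy⇒≡ {i} {x} {j} {h} e
  ... | refl = let k′ , p′ , k′<k = exit-copy out p in k′ , p′ , m<n⇒m<1+n k′<k

  enter-copy : ∀ {i x s k} → Outside i s → Walk⊙ s (copy i x) k →
    ∃ λ k′ → Walk⊙ s (hub i) k′ × k′ < k
  enter-copy out p = let k′ , p′ , k′<k = exit-copy out (reverse p) in k′ , reverse p′ , k′<k

  walk-to-other-hub : ∀ {i j h k} → i ≢ j → Walk⊙ (copy i h) (hub j) k → 2 ≤ k
  walk-to-other-hub i≢j p =
    let _ , p′ , k′<k = exit-copy tt p in ≤-trans (s≤s (walk⊙-nonempty (i≢j ∘ hub-injective) p′)) k′<k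

  walk-to-other-copy : ∀ {i j h x k} → i ≢ j → Walk⊙ (copy i h) (copy j x) k → 3 ≤ k
  walk-to-other-copy i≢j p =
    let _ , p₁ , k₁<k = exit-copy i≢j p
        _ , p₂ , k₂<k₁ = enter-copy tt p₁
    in ≤-trans (s≤s (≤-trans (s≤s (walk⊙-nonempty (i≢j ∘ hub-injective) p₂)) k₂<k₁)) k₁<k

  dist⊙-through-hub : ∀ {i x s c} → Outside i s → Dist⊙ s (hub i) c → Dist⊙ s (copy i x) (suc c)
  dist⊙-through-hub {i} {x} {s} out d =
    dist⊙-intro (snoc (dist⊙-walk {s} {hub i} d) (hub~copy i x)) λ k p →
      let _ , p′ , k′<k = enter-copy out p in ≤-<-trans (dist⊙-minimal {s} {hub i} d p′) k′<k

  equidistant-from-outside : ∀ {i x y s a b} → Outside i s →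
    Dist⊙ s (copy i x) a → Dist⊙ s (copy i y) b → a ≡ b
  equidistant-from-outside out da db =
    let _ , dc = dist⊙-exists (proj₁ (proj₂ (enter-copy out (dist⊙-walk da))))
    in trans (Dist-unique C da (dist⊙-through-hub out dc)) (Dist-unique C (dist⊙-through-hub out dc) db)

  distanceInCopy : Bool → ℕ
  distanceInCopy true  = 1
  distanceInCopy false = 2

  distanceInCopy-injective : ∀ {a b} → distanceInCopy a ≡ distanceInCopy b → a ≡ b
  distanceInCopy-injective {true}  {true}  _ = refl
  distanceInCopy-injective {false} {false} _ = refl

  dist⊙-within-copy : ∀ {i h x} → h ≢ x →
    Dist⊙ (copy i h) (copy i x) (distanceInCopy (adj H h x))
  dist⊙-within-copy {i} {h} {x} h≢x with adj H h x in h∼x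
  ... | true  = dist⊙-intro (step (trans (adj-within-copy i h x) h∼x) here) λ where
      zero    p → ⊥-elim (h≢x (copy-injective (walk⊙-length-zero p)))
      (suc _) _ → s≤s z≤n
  ... | false = dist⊙-intro (step {v = hub i} (copy~hub i h) (step (hub~copy i x) here)) λ where
      zero          p             → ⊥-elim (h≢x (copy-injective (walk⊙-length-zero p)))
      (suc zero)    (step e here) → ⊥-elim (not-adjacent e)
      (suc (suc _)) _             → s≤s (s≤s z≤n)
    where
    not-adjacent : ¬ (copy i h ~ copy i x)
    not-adjacent e with trans (≡.sym h∼x) (trans (≡.sym (adj-within-copy i h x)) e)
    ... | ()

  lookup-++-concat : ∀ (T : Subset n) (rows : Vec (Subset m) n) i h →
    lookup (T ++ concat rows) (enc (copy i h)) ≡ lookup (lookup rows i) h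
  lookup-++-concat T rows i h =
    trans (Vecₚ.lookup-++ʳ T (concat rows) (combine i h)) (Vecₚ.lookup-concat rows i h)

  row-adjacency-generator : ∀ (T : Subset n) (rows : Vec (Subset m) n) →
    IsMetricGenerator C (T ++ concat rows) → ∀ i → IsAdjacencyGenerator H (lookup rows i)
  row-adjacency-generator T rows gen i x y x≢y x∉ y∉
    with gen (enc (copy i x)) (enc (copy i y)) (x≢y ∘ copy-injective ∘ enc-injective)
  ... | s , s∈S , s-dist = resolve (dec s)
          (subst (_∈ T ++ concat rows) (≡.sym (enc-dec s)) s∈S)
          (subst (λ z → Distinguishes C z _ _) (≡.sym (enc-dec s)) s-dist)
    where
    resolve : ∀ σ → enc σ ∈ T ++ concat rows →
      Distinguishes C (enc σ) (enc (copy i x)) (enc (copy i y)) →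
      Σ (Fin m) λ h → h ∈ lookup rows i × ¬ (adj H h x ≡ adj H h y)
    resolve (hub j) _ (_ , _ , da , db , a≢b) = ⊥-elim (a≢b (equidistant-from-outside tt da db))
    resolve (copy j h) σ∈S (a , b , da , db , a≢b) with i Fin.≟ j
    ... | no i≢j   = ⊥-elim (a≢b (equidistant-from-outside i≢j da db))
    ... | yes refl = h , h∈row , λ same → a≢b (begin
        a                            ≡⟨ Dist-unique C da (dist⊙-within-copy h≢x) ⟩
        distanceInCopy (adj H h x)   ≡⟨ cong distanceInCopy same ⟩
        distanceInCopy (adj H h y)   ≡⟨ Dist-unique C (dist⊙-within-copy h≢y) db ⟩
        b                            ∎)
      where
      open ≡.≡-Reasoning
      h∈row : h ∈ lookup rows i
      h∈row = Vecₚ.lookup⇒[]= h _ (trans (≡.sym (lookup-++-concat T rows i h)) (Vecₚ.[]=⇒lookup σ∈S))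
      h≢x : h ≢ x
      h≢x refl = x∉ h∈row
      h≢y : h ≢ y
      h≢y refl = y∉ h∈row

  metric-generator-size : ∀ {S a} → IsMetricGenerator C S →
    (∀ B → IsAdjacencyGenerator H B → a ≤ ∣ B ∣) → n * a ≤ ∣ S ∣
  -- Split S into its hub part T and its rows, row i being the trace of S on H_i.
  metric-generator-size {S} {a} gen a-minimal with Vec.splitAt n S
  ... | T , R , refl with group n m R
  ...   | rows , refl = begin
      n * a                    ≤⟨ *≤sum (map ∣_∣ rows) row-size ⟩
      sum (map ∣_∣ rows)       ≡⟨ ≡.sym (∣concat∣≡sum rows) ⟩
      ∣ concat rows ∣          ≤⟨ m≤n+m _ _ ⟩
      ∣ T ∣ + ∣ concat rows ∣  ≡⟨ ≡.sym (∣p++q∣≡∣p∣+∣q∣ T (concat rows)) ⟩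
      ∣ T ++ concat rows ∣     ∎
    where
    open Data.Nat.Properties.≤-Reasoning
    row-size : ∀ i → a ≤ lookup (map ∣_∣ rows) i
    row-size i = subst (a ≤_) (≡.sym (Vecₚ.lookup-map i ∣_∣ rows))
                       (a-minimal _ (row-adjacency-generator T rows gen i))

  module UpperBound (connected : Connected G) (2≤n : 2 ≤ n) {A : Subset m}
                    (A-gen : IsAdjacencyGenerator H A) (A-nonempty : Nonempty A) where

    S : Subset (n + n * m)
    S = ⊥ ++ concat (replicate n A)

    copy-∈S : ∀ {i h} → h ∈ A → enc (copy i h) ∈ S
    copy-∈S {i} {h} h∈A = Vecₚ.lookup⇒[]= _ S (begin
      lookup S (enc (copy i h))           ≡⟨ lookup-++-concat ⊥ (replicate n A) i h ⟩
      lookup (lookup (replicate n A) i) h ≡⟨ cong (λ r → lookup r h) (Vecₚ.lookup-replicate i A) ⟩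
      lookup A h                          ≡⟨ Vecₚ.[]=⇒lookup h∈A ⟩
      true                                ∎)
      where open ≡.≡-Reasoning

    ∣S∣≡n*∣A∣ : ∣ S ∣ ≡ n * ∣ A ∣
    ∣S∣≡n*∣A∣ = begin
      ∣ ⊥ {n} ++ concat (replicate n A) ∣     ≡⟨ ∣p++q∣≡∣p∣+∣q∣ (⊥ {n}) _ ⟩
      ∣ ⊥ {n} ∣ + ∣ concat (replicate n A) ∣  ≡⟨ cong₂ _+_ (Subsetₚ.∣⊥∣≡0 n) (∣concat∣≡sum (replicate n A)) ⟩
      sum (map ∣_∣ (replicate n A))           ≡⟨ cong sum (Vecₚ.map-replicate ∣_∣ A n) ⟩
      sum (replicate n ∣ A ∣)                 ≡⟨ sum-replicate n ∣ A ∣ ⟩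
      n * ∣ A ∣                               ∎
      where open ≡.≡-Reasoning

    Resolved : Vertex → Vertex → Set
    Resolved u v = ∃₂ λ i h → h ∈ A × Distinguishes C (enc (copy i h)) (enc u) (enc v)

    resolved-sym : ∀ {u v} → Resolved u v → Resolved v u
    resolved-sym (i , h , h∈A , d) = i , h , h∈A , distinguishes-sym C d

    h₀ : Fin m
    h₀ = proj₁ A-nonempty

    h₀∈A : h₀ ∈ A
    h₀∈A = proj₂ A-nonempty

    resolved-by-walks : ∀ {i p} u v → Walk⊙ (copy i h₀) u p →
      (∀ k → Walk⊙ (copy i h₀) v k → p < k) → Resolved u v
    resolved-by-walks _ _ pu longer =
      _ , _ , h₀∈A , distinguishes⊙-by-walks pu (proj₂ (connected⊙ connected _ _)) longer

    hub-hub : ∀ {i j} → i ≢ j → Resolved (hub i) (hub j)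
    hub-hub {i} {j} i≢j =
      resolved-by-walks (hub i) (hub j) (step (copy~hub i h₀) here) (λ _ → walk-to-other-hub i≢j)

    hub-own-copy : ∀ i h → Resolved (hub i) (copy i h)
    hub-own-copy i h =
      let k , k≢i = another-vertex 2≤n i
          c , dc  = dist⊙-exists (proj₂ (connected⊙ connected (copy k h₀) (hub i)))
      in k , h₀ , h₀∈A , c , suc c , dc , dist⊙-through-hub (k≢i ∘ ≡.sym) dc , 1+n≢n ∘ ≡.sym

    hub-other-copy : ∀ {i j h} → i ≢ j → Resolved (hub i) (copy j h)
    hub-other-copy {i} {j} {h} i≢j =
      resolved-by-walks (hub i) (copy j h) (step (copy~hub i h₀) here)
        (λ _ → ≤-trans (s≤s (s≤s z≤n)) ∘ walk-to-other-copy i≢j)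

    copy-other-copy : ∀ {i j h x} → i ≢ j → Resolved (copy i h) (copy j x)
    copy-other-copy {i} {j} {h} {x} i≢j =
      resolved-by-walks (copy i h) (copy j x) (step {v = hub i} (copy~hub i h₀) (step (hub~copy i h) here))
        (λ _ → walk-to-other-copy i≢j)

    within-copy : ∀ i {h x} → h ≢ x → Resolved (copy i h) (copy i x)
    within-copy i {h} {x} h≢x with h Subsetₚ.∈? A | x Subsetₚ.∈? A
    ... | yes h∈A | _ =
      i , h , h∈A , distinguishes⊙-by-walks {v = copy i x} here (proj₂ (connected⊙ connected _ _))
                      (λ _ → walk⊙-nonempty (h≢x ∘ copy-injective))
    ... | no _ | yes x∈A =
      i , x , x∈A , distinguishes-sym C (distinguishes⊙-by-walks {v = copy i h} here
                      (proj₂ (connected⊙ connected _ _)) (λ _ → walk⊙-nonempty (h≢x ∘ ≡.sym ∘ copy-injective)))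
    ... | no h∉A | no x∉A with A-gen h x h≢x h∉A x∉A
    ...   | s , s∈A , s-separates =
      i , s , s∈A , _ , _ , dist⊙-within-copy s≢h , dist⊙-within-copy s≢x , s-separates ∘ distanceInCopy-injective
      where
      s≢h : s ≢ h
      s≢h refl = h∉A s∈A
      s≢x : s ≢ x
      s≢x refl = x∉A s∈A

    resolve : ∀ u v → u ≢ v → Resolved u v
    resolve (hub i)    (hub j)    u≢v = hub-hub (u≢v ∘ cong hub)
    resolve (hub i)    (copy j h) _   with i Fin.≟ j
    ... | yes refl = hub-own-copy i h
    ... | no i≢j   = hub-other-copy i≢j
    resolve (copy j h) (hub i)    v≢u =
      resolved-sym {hub i} {copy j h} (resolve (hub i) (copy j h) (v≢u ∘ ≡.sym))
    resolve (copy i h) (copy j x) u≢v with i Fin.≟ j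
    ... | yes refl = within-copy i (u≢v ∘ cong (copy i))
    ... | no i≢j   = copy-other-copy i≢j

    metric-generator : IsMetricGenerator C S
    metric-generator x y x≢y with resolve (dec x) (dec y) (x≢y ∘ dec-injective)
    ... | i , h , h∈A , d =
      enc (copy i h) , copy-∈S h∈A , subst₂ (Distinguishes C _) (enc-dec x) (enc-dec y) d

theorem1 : ∀ {n m} (G : Graph n) (H : Graph m) → Connected G → 2 ≤ n → 2 ≤ m →
    ∀ a → IsAdjacencyDimension H a → IsMetricDimension (corona G H) (n * a)
theorem1 {n} G H connected 2≤n 2≤m a ((A , A-gen , ∣A∣≡a) , a-minimal) =
  (S , metric-generator , trans ∣S∣≡n*∣A∣ (cong (n *_) ∣A∣≡a)) ,
  λ _ gen → metric-generator-size gen a-minimal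
  where
  open Corona G H
  open UpperBound connected 2≤n A-gen (adjacency-generator-nonempty H 2≤m A-gen)
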